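{- Let $\mathbb K$ be a field of characteristic $>n$ (or $0$), $n\ge2$, and $1\le r\le n-1$ with $\gcd(r,n)=1$. Let $r^*\in\{1,\ldots,n-1\}$ and the integer $Q$ be defined by $rr^*=1+Qn$. Then the inverse of $M_n(0,1,r)$ is $M_n(-Q/r,\,1-Q/r,\,r^*)$.
   Context: For distinct $a,b\in\mathbb K$ (declared ordered $a<b$) and $r\in\{0,\ldots,n-1\}$ coprime to $n$, $M_n(a,b,r)$ is the $n\times n$ matrix whose rows are the $n$ distinct cyclic rotations of the lower Christoffel word over $\{a<b\}$ with $n-r$ letters $a$ and $r$ letters $b$, listed in decreasing lexicographic order (w.r.t. $a<b$) from top to bottom. Here the lower Christoffel word with $p$ letters $a$ and $q$ letters $b$ ($p+q=n$, $\gcd(p,q)=1$) is $c_0\cdots c_{n-1}$ with $c_i=b$ iff $\lfloor (i+1)q/n\rfloor>\lfloor iq/n\rfloor$, else $c_i=a$. In $M_n(-Q/r,1-Q/r,r^*)$ the alphabet is ordered $-Q/r<1-Q/r$. -}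

module Defs where

open import Level using (Level; _⊔_) renaming (suc to lsuc)
open import Data.Bool using (Bool; true; false; if_then_else_)
open import Data.Nat using (ℕ; zero; suc; _<ᵇ_)
import Data.Nat as N
open import Data.Nat.DivMod using (_/_; _mod_)
open import Data.Integer using (ℤ; +_; -[1+_])
open import Data.Fin using (Fin; toℕ) renaming (zero to fzero; suc to fsuc)
open import Data.Fin.Properties using () renaming (_≟_ to _≟ᶠ_)
open import Relation.Nullary using (¬_; yes; no)
open import Relation.Nullary.Decidable using (⌊_⌋)
open import Algebra.Bundles using (CommutativeRing)
open import Data.Product using (_,_)
import Data.Maybe
open import Data.Maybe using (Maybe; just; nothing)

record Field (c ℓ : Level) : Set (lsuc (c ⊔ ℓ)) where
  field
    commutativeRing : CommutativeRing c ℓ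
  open CommutativeRing commutativeRing public
  field
    0≉1      : ¬ (0# ≈ 1#)
    _⁻¹      : Carrier → Carrier
    ⁻¹-inv   : ∀ x → ¬ (x ≈ 0#) → x * (x ⁻¹) ≈ 1#

module FieldOps {c ℓ : Level} (F : Field c ℓ) where
  open Field F

  _·1 : ℕ → Carrier
  zero  ·1 = 0#
  suc k ·1 = 1# + (k ·1)

  fromℤ : ℤ → Carrier
  fromℤ (+ k)     = k ·1
  fromℤ -[1+ k ]  = - (suc k ·1)

  -- characteristic of F is 0 or > n  ⇔  k·1 ≉ 0 for every 1 ≤ k ≤ n
  CharZeroOrGreaterThan : ℕ → Set ℓ
  CharZeroOrGreaterThan n = ∀ k → 1 N.≤ k → k N.≤ n → ¬ ((k ·1) ≈ 0#)

  _÷_ : Carrier → Carrier → Carrier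
  x ÷ y = x * (y ⁻¹)

  ∑ : ∀ {n} → (Fin n → Carrier) → Carrier
  ∑ {zero}  f = 0#
  ∑ {suc n} f = f fzero + ∑ (λ i → f (fsuc i))

  Matrix : ℕ → Set c
  Matrix n = Fin n → Fin n → Carrier

  _⊗_ : ∀ {n} → Matrix n → Matrix n → Matrix n
  (A ⊗ B) i j = ∑ (λ k → A i k * B k j)

  identity : ∀ {n} → Matrix n
  identity i j = if ⌊ i ≟ᶠ j ⌋ then 1# else 0#

  _≈ₘ_ : ∀ {n} → Matrix n → Matrix n → Set ℓ
  A ≈ₘ B = ∀ i j → A i j ≈ B i j

  IsInverseOf : ∀ {n} → Matrix n → Matrix n → Set ℓ
  IsInverseOf B A = ((A ⊗ B) ≈ₘ identity) Data.Product.× ((B ⊗ A) ≈ₘ identity)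

-- Words over the ordered two-letter alphabet {a < b}, encoded as
-- Bool with false = a, true = b (so a < b corresponds to false < true).

Word : ℕ → Set
Word n = Fin n → Bool

-- lower Christoffel word of length n with q letters b:
-- c_i = b  iff  ⌊(i+1)q/n⌋ > ⌊iq/n⌋
christoffel : (n q : ℕ) → Word n
christoffel zero    q ()
christoffel (suc m) q i =
  ((toℕ i N.* q) / suc m) <ᵇ ((suc (toℕ i) N.* q) / suc m)

rotate : ∀ {n} → Word n → Fin n → Word n
rotate {zero}  w ()
rotate {suc m} w k i = w ((toℕ i N.+ toℕ k) mod suc m)

lexGt : ∀ {n} → Word n → Word n → Bool
lexGt {zero}  u v = false
lexGt {suc n} u v with u fzero | v fzero
... | true  | false = true
... | false | true  = false
... | _     | _     = lexGt (λ i → u (fsuc i)) (λ i → v (fsuc i))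

count : ∀ {n} → (Fin n → Bool) → ℕ
count {zero}  p = 0
count {suc n} p = (if p fzero then 1 else 0) N.+ count (λ i → p (fsuc i))

rank : ∀ {n} → Word n → Fin n → ℕ
rank w k = count (λ k' → lexGt (rotate w k') (rotate w k))

findFin : ∀ {n} → (Fin n → Bool) → Maybe (Fin n)
findFin {zero}  p = nothing
findFin {suc n} p = if p fzero then just fzero
                    else Data.Maybe.map fsuc (findFin (λ i → p (fsuc i)))

-- j-th row (0-indexed, from the top) of the matrix of rotations of w
-- listed in decreasing lexicographic order: the rotation of rank j.
-- (When the n rotations are distinct -- true for Christoffel words with
-- gcd(r,n)=1 -- exactly one rotation has rank j; the fallback `nothing`
-- branch is then never used.)
sortedRow : ∀ {n} → Word n → Fin n → Word n
sortedRow w j with findFin (λ k → rank w k N.≡ᵇ toℕ j)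
... | just k  = rotate w k
... | nothing = λ _ → false

module _ {c ℓ : Level} (F : Field c ℓ) where
  open Field F
  open FieldOps F

  M : (n : ℕ) → Carrier → Carrier → ℕ → Matrix n
  M n a b r i j = if sortedRow (christoffel n r) i j then b else a

module Submission where

-- Write n = m + 1. The rotation of the Christoffel word (with q letters b) by k is the
-- mechanical word whose letter i is [n ∸ q ≤ (iq + s) mod n] with intercept s = kq mod n,
-- and the lexicographic order of these rotations is the order of their intercepts; so
-- row j of M_n(0,1,q) is the mechanical word with intercept m ∸ j.  Entry (j,l) of
-- M_n(0,1,r)·M_n(−γ,1−γ,r*) is #{k : both letters are b} − γ·r.  Reindexing k by the
-- shift l·r* turns the second letter into [k < r*], after which the count telescopes to
-- ⌊(r r* + c)/n⌋ − ⌊c/n⌋ = Q + [j = l] with c = m ∸ j + l.  As rγ = Q the entry is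
-- [j = l]; the other product is the same computation, using that every column of
-- M_n(0,1,r) also contains r letters b.

open import Defs

module Combinatorics where
  open import Data.Nat
  open import Data.Nat.Properties
  open import Data.Nat.DivMod
  open import Data.Nat.Divisibility using (n∣m*n)
  open import Data.Nat.Tactic.RingSolver using (solve-∀)
  open import Data.Bool using (Bool; true; false; T; _∧_; if_then_else_)
  open import Data.Bool.Properties using (∧-zeroʳ; ∧-identityʳ)
  open import Algebra.Properties.CommutativeSemigroup +-commutativeSemigroup using (xy∙z≈y∙xz; xy∙z≈y∙zx; xy∙z≈xz∙y; xy∙z≈z∙xy)
  open import Data.Fin using (Fin; toℕ; fromℕ<) renaming (zero to fzero; suc to fsuc)
  open import Data.Fin.Properties using (toℕ-fromℕ<; toℕ-injective; toℕ<n) renaming (_≟_ to _≟ᶠ_)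
  open import Relation.Nullary.Decidable using (⌊_⌋)
  open import Data.Fin.Permutation using (permutation)
  open import Data.Maybe using (just; nothing)
  open import Data.Product using (∃; _,_)
  import Algebra.Properties.CommutativeMonoid.Sum +-0-commutativeMonoid as FinSum
  open import Data.Sum using (inj₁; inj₂)
  open import Relation.Nullary using (Dec; yes; no; ¬_; contradiction)
  open import Relation.Binary.PropositionalEquality
  open import Relation.Binary.Definitions using (tri<; tri≈; tri>)
  open ≡-Reasoning

  ⟦_⟧ : Bool → ℕ
  ⟦ b ⟧ = if b then 1 else 0

  ≤ᵇ-true : ∀ {m n} → m ≤ n → (m ≤ᵇ n) ≡ true
  ≤ᵇ-true {m} {n} m≤n with m ≤ᵇ n | ≤⇒≤ᵇ m≤n
  ... | true | _ = refl

  ≤ᵇ-false : ∀ {m n} → n < m → (m ≤ᵇ n) ≡ false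
  ≤ᵇ-false {m} {n} n<m with m ≤ᵇ n in eq
  ... | false = refl
  ... | true  = contradiction (≤ᵇ⇒≤ m n (subst T (sym eq) _)) (<⇒≱ n<m)

  ≡ᵇ-true : ∀ {m n} → m ≡ n → (m ≡ᵇ n) ≡ true
  ≡ᵇ-true {m} {n} m≡n with m ≡ᵇ n | ≡⇒≡ᵇ m n m≡n
  ... | true | _ = refl

  ≡ᵇ-false : ∀ {m n} → m ≢ n → (m ≡ᵇ n) ≡ false
  ≡ᵇ-false {m} {n} m≢n with m ≡ᵇ n in eq
  ... | false = refl
  ... | true  = contradiction (≡ᵇ⇒≡ m n (subst T (sym eq) _)) m≢n

  ⌊≟⌋≡toℕ-≡ᵇ : ∀ {N} (j l : Fin N) → ⌊ j ≟ᶠ l ⌋ ≡ (toℕ j ≡ᵇ toℕ l)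
  ⌊≟⌋≡toℕ-≡ᵇ j l with j ≟ᶠ l
  ... | yes refl = sym (≡ᵇ-true {toℕ j} refl)
  ... | no j≢l   = sym (≡ᵇ-false (λ eq → j≢l (toℕ-injective eq)))

  <ᵇ-⟦⟧+ : ∀ b a → (a <ᵇ ⟦ b ⟧ + a) ≡ b
  <ᵇ-⟦⟧+ true  a = ≤ᵇ-true {suc a} ≤-refl
  <ᵇ-⟦⟧+ false a = ≤ᵇ-false {suc a} ≤-refl

  sum< : ℕ → (ℕ → ℕ) → ℕ
  sum< zero    f = 0
  sum< (suc k) f = sum< k f + f k

  sum<-cong : ∀ k {f g : ℕ → ℕ} → (∀ {x} → x < k → f x ≡ g x) → sum< k f ≡ sum< k g
  sum<-cong zero    eq = refl
  sum<-cong (suc k) eq = cong₂ _+_ (sum<-cong k (λ x<k → eq (m<n⇒m<1+n x<k))) (eq (n<1+n k))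

  sum<-head : ∀ k (f : ℕ → ℕ) → sum< (suc k) f ≡ f 0 + sum< k (λ x → f (suc x))
  sum<-head zero    f = +-comm 0 (f 0)
  sum<-head (suc k) f = begin
    sum< (suc k) f + f (suc k)                  ≡⟨ cong (_+ f (suc k)) (sum<-head k f) ⟩
    f 0 + sum< k (λ x → f (suc x)) + f (suc k)  ≡⟨ +-assoc (f 0) _ _ ⟩
    f 0 + sum< (suc k) (λ x → f (suc x))        ∎

  sum<-periodic : ∀ N (h : ℕ → ℕ) → (∀ x → h (x + N) ≡ h x) →
                  ∀ c → sum< N (λ x → h (x + c)) ≡ sum< N h
  sum<-periodic N h per zero    = sum<-cong N (λ {x} _ → cong h (+-identityʳ x))
  sum<-periodic N h per (suc c) = begin
    sum< N (λ x → h (x + suc c))  ≡⟨ sum<-cong N (λ {x} _ → cong h (+-suc x c)) ⟩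
    sum< N (λ x → g (suc x))      ≡⟨ +-cancelˡ-≡ (g 0) _ _ rotated ⟩
    sum< N g                      ≡⟨ sum<-periodic N h per c ⟩
    sum< N h                      ∎
    where
    g : ℕ → ℕ
    g y = h (y + c)
    rotated : g 0 + sum< N (λ x → g (suc x)) ≡ g 0 + sum< N g
    rotated = begin
      g 0 + sum< N (λ x → g (suc x))  ≡⟨ sum<-head N g ⟨
      sum< N g + g N                  ≡⟨ cong (sum< N g +_) (trans (cong h (+-comm N c)) (per c)) ⟩
      sum< N g + g 0                  ≡⟨ +-comm (sum< N g) (g 0) ⟩
      g 0 + sum< N g                  ∎

  sum<-reverse : ∀ k (f : ℕ → ℕ) → sum< (suc k) (λ x → f (k ∸ x)) ≡ sum< (suc k) f
  sum<-reverse zero    f = refl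
  sum<-reverse (suc k) f = begin
    sum< (suc (suc k)) (λ x → f (suc k ∸ x))
      ≡⟨ cong₂ _+_ (sum<-cong (suc k) (λ x≤k → cong f (+-∸-assoc 1 (s≤s⁻¹ x≤k)))) (cong f (n∸n≡0 k)) ⟩
    sum< (suc k) (λ x → f (suc (k ∸ x))) + f 0 ≡⟨ cong (_+ f 0) (sum<-reverse k (λ y → f (suc y))) ⟩
    sum< (suc k) (λ x → f (suc x)) + f 0       ≡⟨ +-comm _ (f 0) ⟩
    f 0 + sum< (suc k) (λ x → f (suc x))       ≡⟨ sum<-head (suc k) f ⟨
    sum< (suc (suc k)) f                       ∎

  sum<-∧-<ᵇ : ∀ N k (g : ℕ → Bool) → k ≤ N →
              sum< N (λ x → ⟦ g x ∧ (x <ᵇ k) ⟧) ≡ sum< k (λ x → ⟦ g x ⟧)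
  sum<-∧-<ᵇ N k g k≤N with m≤n⇒m<n∨m≡n k≤N
  sum<-∧-<ᵇ N k g k≤N | inj₂ refl = sum<-cong N below
    where
    below : ∀ {x} → x < N → ⟦ g x ∧ (x <ᵇ N) ⟧ ≡ ⟦ g x ⟧
    below {x} x<N = cong ⟦_⟧ (trans (cong (g x ∧_) (≤ᵇ-true {suc x} x<N)) (∧-identityʳ (g x)))
  sum<-∧-<ᵇ (suc N) k g k≤N | inj₁ k<1+N = begin
    sum< N (λ x → ⟦ g x ∧ (x <ᵇ k) ⟧) + ⟦ g N ∧ (N <ᵇ k) ⟧
      ≡⟨ cong₂ _+_ (sum<-∧-<ᵇ N k g (s≤s⁻¹ k<1+N)) (cong (λ b → ⟦ g N ∧ b ⟧) (≤ᵇ-false {suc N} k<1+N)) ⟩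
    sum< k (λ x → ⟦ g x ⟧) + ⟦ g N ∧ false ⟧
      ≡⟨ cong (λ b → sum< k (λ x → ⟦ g x ⟧) + ⟦ b ⟧) (∧-zeroʳ (g N)) ⟩
    sum< k (λ x → ⟦ g x ⟧) + 0
      ≡⟨ +-identityʳ _ ⟩
    sum< k (λ x → ⟦ g x ⟧) ∎

  sum<-≤ᵇ : ∀ N k → sum< N (λ x → ⟦ k ≤ᵇ x ⟧) ≡ N ∸ k
  sum<-≤ᵇ zero    k = sym (0∸n≡0 k)
  sum<-≤ᵇ (suc N) k with k ≤? N
  ... | yes k≤N = begin
    sum< N (λ x → ⟦ k ≤ᵇ x ⟧) + ⟦ k ≤ᵇ N ⟧ ≡⟨ cong₂ _+_ (sum<-≤ᵇ N k) (cong ⟦_⟧ (≤ᵇ-true k≤N)) ⟩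
    N ∸ k + 1                             ≡⟨ +-∸-comm 1 k≤N ⟨
    N + 1 ∸ k                             ≡⟨ cong (_∸ k) (+-comm N 1) ⟩
    suc N ∸ k                             ∎
  ... | no k≰N = begin
    sum< N (λ x → ⟦ k ≤ᵇ x ⟧) + ⟦ k ≤ᵇ N ⟧ ≡⟨ cong₂ _+_ (sum<-≤ᵇ N k) (cong ⟦_⟧ (≤ᵇ-false (≰⇒> k≰N))) ⟩
    N ∸ k + 0                             ≡⟨ cong (_+ 0) (m≤n⇒m∸n≡0 (<⇒≤ (≰⇒> k≰N))) ⟩
    0                                     ≡⟨ m≤n⇒m∸n≡0 (≰⇒> k≰N) ⟨
    suc N ∸ k                             ∎

  count≡sum< : ∀ {N} (p : Fin N → Bool) (g : ℕ → Bool) → (∀ i → p i ≡ g (toℕ i)) →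
               count p ≡ sum< N (λ x → ⟦ g x ⟧)
  count≡sum< {zero}  p g eq = refl
  count≡sum< {suc N} p g eq = begin
    ⟦ p fzero ⟧ + count (λ i → p (fsuc i))
      ≡⟨ cong₂ _+_ (cong ⟦_⟧ (eq fzero)) (count≡sum< _ (λ x → g (suc x)) (λ i → eq (fsuc i))) ⟩
    ⟦ g 0 ⟧ + sum< N (λ x → ⟦ g (suc x) ⟧)   ≡⟨ sum<-head N (λ x → ⟦ g x ⟧) ⟨
    sum< (suc N) (λ x → ⟦ g x ⟧)             ∎

  sum≡sum< : ∀ {N} (f : ℕ → ℕ) → FinSum.sum {N} (λ i → f (toℕ i)) ≡ sum< N f
  sum≡sum< {zero}  f = refl
  sum≡sum< {suc N} f = trans (cong (f 0 +_) (sum≡sum< {N} (λ x → f (suc x)))) (sym (sum<-head N f))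

  module _ {n : ℕ} .{{_ : NonZero n}} where

    %-cong-multiples : ∀ a b k l → a + k * n ≡ b + l * n → a % n ≡ b % n
    %-cong-multiples a b k l eq = begin
      a % n            ≡⟨ [m+kn]%n≡m%n a k n ⟨
      (a + k * n) % n  ≡⟨ cong (_% n) eq ⟩
      (b + l * n) % n  ≡⟨ [m+kn]%n≡m%n b l n ⟩
      b % n            ∎

    %-unique : ∀ {a x} k → a ≡ x + k * n → x < n → a % n ≡ x
    %-unique {a} {x} k eq x<n =
      trans (%-cong-multiples a x 0 k (trans (+-identityʳ a) eq)) (m<n⇒m%n≡m x<n)

    /-unique : ∀ {a x} k → a ≡ x + k * n → x < n → a / n ≡ k
    /-unique {a} {x} k eq x<n = *-cancelʳ-≡ (a / n) k n (+-cancelˡ-≡ x _ _ (begin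
      x + a / n * n      ≡⟨ cong (_+ a / n * n) (%-unique k eq x<n) ⟨
      a % n + a / n * n  ≡⟨ m≡m%n+[m/n]*n a n ⟨
      a                  ≡⟨ eq ⟩
      x + k * n          ∎))

    /-+-multiple : ∀ a k → (a + k * n) / n ≡ a / n + k
    /-+-multiple a k = trans (+-distrib-/-∣ʳ a (n∣m*n k)) (cong (a / n +_) (m*n/n≡m k n))

    toℕ-mod : ∀ a → toℕ (a mod n) ≡ a % n
    toℕ-mod a = toℕ-fromℕ< (m%n<n a n)

    [m%n]*o+[m/n]*o*n≡m*o : ∀ a b → a % n * b + a / n * b * n ≡ a * b
    [m%n]*o+[m/n]*o*n≡m*o a b = trans (expand (a % n) (a / n) n b) (cong (_* b) (sym (m≡m%n+[m/n]*n a n)))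
      where
      expand : ∀ r t n b → r * b + t * b * n ≡ (r + t * n) * b
      expand = solve-∀

    %-*-inverse : ∀ {a b K} → a * b ≡ 1 + K * n → ∀ {y} → y < n → ((y * a) % n * b) % n ≡ y
    %-*-inverse {a} {b} {K} ab {y} y<n =
      trans (%-cong-multiples _ y (y * a / n * b) (y * K) (begin
        (y * a) % n * b + y * a / n * b * n  ≡⟨ [m%n]*o+[m/n]*o*n≡m*o (y * a) b ⟩
        y * a * b                            ≡⟨ *-assoc y a b ⟩
        y * (a * b)                          ≡⟨ cong (y *_) ab ⟩
        y * (1 + K * n)                      ≡⟨ expand₂ y K n ⟩
        y + y * K * n                        ∎)) (m<n⇒m%n≡m y<n)
      where
      expand₂ : ∀ y K n → y * (1 + K * n) ≡ y + y * K * n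
      expand₂ = solve-∀

    /-carry : ∀ q a → q ≤ n → (q + a) / n ≡ ⟦ n ∸ q ≤ᵇ a % n ⟧ + a / n
    /-carry q a q≤n with n ∸ q ≤? a % n
    ... | yes n∸q≤x = begin
      (q + a) / n                   ≡⟨ /-unique (suc (a / n)) carried (m<n+o⇒m∸n<o (q + a % n) n (+-mono-≤-< q≤n (m%n<n a n))) ⟩
      1 + a / n                     ≡⟨ cong (λ b → ⟦ b ⟧ + a / n) (≤ᵇ-true n∸q≤x) ⟨
      ⟦ n ∸ q ≤ᵇ a % n ⟧ + a / n    ∎
      where
      n≤q+x : n ≤ q + a % n
      n≤q+x = subst (_≤ q + a % n) (m+[n∸m]≡n q≤n) (+-monoʳ-≤ q n∸q≤x)
      carried : q + a ≡ (q + a % n ∸ n) + suc (a / n) * n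
      carried = begin
        q + a                                 ≡⟨ cong (q +_) (m≡m%n+[m/n]*n a n) ⟩
        q + (a % n + a / n * n)               ≡⟨ +-assoc q (a % n) _ ⟨
        q + a % n + a / n * n                 ≡⟨ cong (_+ a / n * n) (m∸n+n≡m n≤q+x) ⟨
        (q + a % n ∸ n) + n + a / n * n       ≡⟨ +-assoc (q + a % n ∸ n) n _ ⟩
        (q + a % n ∸ n) + suc (a / n) * n     ∎
    ... | no n∸q≰x = begin
      (q + a) / n                   ≡⟨ /-unique (a / n) uncarried q+x<n ⟩
      a / n                         ≡⟨ cong (λ b → ⟦ b ⟧ + a / n) (≤ᵇ-false (≰⇒> n∸q≰x)) ⟨
      ⟦ n ∸ q ≤ᵇ a % n ⟧ + a / n    ∎
      where
      q+x<n : q + a % n < n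
      q+x<n = subst (q + a % n <_) (m+[n∸m]≡n q≤n) (+-monoʳ-< q (≰⇒> n∸q≰x))
      uncarried : q + a ≡ (q + a % n) + a / n * n
      uncarried = trans (cong (q +_) (m≡m%n+[m/n]*n a n)) (sym (+-assoc q (a % n) _))

  lexStep : Bool → Bool → Bool → Bool
  lexStep true  false _ = true
  lexStep false true  _ = false
  lexStep _     _     r = r

  lexGt-suc : ∀ {L} (u v : Word (suc L)) →
              lexGt u v ≡ lexStep (u fzero) (v fzero) (lexGt (λ i → u (fsuc i)) (λ i → v (fsuc i)))
  lexGt-suc u v with u fzero | v fzero
  ... | true  | true  = refl
  ... | true  | false = refl
  ... | false | true  = refl
  ... | false | false = refl

  lexGt-cong : ∀ {L} {u u' v v' : Word L} → (∀ i → u i ≡ u' i) → (∀ i → v i ≡ v' i) →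
               lexGt u v ≡ lexGt u' v'
  lexGt-cong {zero}              eu ev = refl
  lexGt-cong {suc L} {u} {u'} {v} {v'} eu ev = begin
    lexGt u v
      ≡⟨ lexGt-suc u v ⟩
    lexStep (u fzero) (v fzero) (lexGt (λ i → u (fsuc i)) (λ i → v (fsuc i)))
      ≡⟨ cong₂ (λ a b → lexStep a b (lexGt (λ i → u (fsuc i)) (λ i → v (fsuc i)))) (eu fzero) (ev fzero) ⟩
    lexStep (u' fzero) (v' fzero) (lexGt (λ i → u (fsuc i)) (λ i → v (fsuc i)))
      ≡⟨ cong (lexStep (u' fzero) (v' fzero)) (lexGt-cong (λ i → eu (fsuc i)) (λ i → ev (fsuc i))) ⟩
    lexStep (u' fzero) (v' fzero) (lexGt (λ i → u' (fsuc i)) (λ i → v' (fsuc i)))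
      ≡⟨ lexGt-suc u' v' ⟨
    lexGt u' v' ∎

  findFin-just : ∀ {N} (p : Fin N → Bool) {k} → findFin p ≡ just k → p k ≡ true
  findFin-just {suc N} p eq with p fzero in e0
  findFin-just {suc N} p refl | true = e0
  ... | false with findFin (λ i → p (fsuc i)) in e1
  findFin-just {suc N} p refl | false | just k = findFin-just (λ i → p (fsuc i)) e1

  findFin-nothing : ∀ {N} (p : Fin N → Bool) → findFin p ≡ nothing → ∀ k → p k ≡ false
  findFin-nothing {suc N} p eq k with p fzero in e0
  findFin-nothing {suc N} p () k | true
  ... | false with findFin (λ i → p (fsuc i)) in e1
  findFin-nothing {suc N} p refl fzero    | false | nothing = e0
  findFin-nothing {suc N} p refl (fsuc k) | false | nothing = findFin-nothing (λ i → p (fsuc i)) e1 k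

  sortedRow-elim : ∀ {N} (w : Word N) j (P : Word N → Set) →
                   (∀ k → rank w k ≡ toℕ j → P (rotate w k)) → ∃ (λ k → rank w k ≡ toℕ j) →
                   P (sortedRow w j)
  sortedRow-elim w j P rows-of-rank-j (k₀ , rank≡j) with findFin (λ k → rank w k ≡ᵇ toℕ j) in eq
  ... | just k  = rows-of-rank-j k (≡ᵇ⇒≡ _ _ (subst T (sym (findFin-just _ eq)) _))
  ... | nothing = contradiction (trans (sym (≡ᵇ-true rank≡j)) (findFin-nothing _ eq k₀)) λ ()

  module MechanicalWords (m : ℕ) where

    n : ℕ
    n = suc m

    -- Letter i of the lower mechanical word of slope q/n and intercept s/n:
    -- by /-carry it equals ⌊((i+1)q+s)/n⌋ ∸ ⌊(iq+s)/n⌋.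
    mechanical : ℕ → ℕ → ℕ → Bool
    mechanical q s i = n ∸ q ≤ᵇ (i * q + s) % n

    sum<-mechanical : ∀ q → q ≤ n → ∀ k s →
                      sum< k (λ i → ⟦ mechanical q s i ⟧) + s / n ≡ (k * q + s) / n
    sum<-mechanical q q≤n zero    s = refl
    sum<-mechanical q q≤n (suc k) s = begin
      sum< k (λ i → ⟦ mechanical q s i ⟧) + ⟦ mechanical q s k ⟧ + s / n
        ≡⟨ xy∙z≈y∙xz (sum< k (λ i → ⟦ mechanical q s i ⟧)) ⟦ mechanical q s k ⟧ (s / n) ⟩
      ⟦ mechanical q s k ⟧ + (sum< k (λ i → ⟦ mechanical q s i ⟧) + s / n)
        ≡⟨ cong (⟦ mechanical q s k ⟧ +_) (sum<-mechanical q q≤n k s) ⟩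
      ⟦ mechanical q s k ⟧ + (k * q + s) / n
        ≡⟨ /-carry q (k * q + s) q≤n ⟨
      (q + (k * q + s)) / n
        ≡⟨ cong (_/ n) (+-assoc q (k * q) s) ⟨
      (suc k * q + s) / n ∎

    mechanical-count : ∀ q → q ≤ n → ∀ s → sum< n (λ i → ⟦ mechanical q s i ⟧) ≡ q
    mechanical-count q q≤n s = +-cancelʳ-≡ (s / n) _ _ (begin
      sum< n (λ i → ⟦ mechanical q s i ⟧) + s / n  ≡⟨ sum<-mechanical q q≤n n s ⟩
      (n * q + s) / n                              ≡⟨ cong (_/ n) (trans (+-comm (n * q) s) (cong (s +_) (*-comm n q))) ⟩
      (s + q * n) / n                              ≡⟨ /-+-multiple s q ⟩
      s / n + q                                    ≡⟨ +-comm (s / n) q ⟩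
      q + s / n                                    ∎)

    residue-window-count : ∀ q → q ≤ n → ∀ c → sum< n (λ y → ⟦ n ∸ q ≤ᵇ (c + y) % n ⟧) ≡ q
    residue-window-count q q≤n c = begin
      sum< n (λ y → ⟦ n ∸ q ≤ᵇ (c + y) % n ⟧)  ≡⟨ sum<-cong n (λ {y} _ → cong (λ z → h z) (+-comm c y)) ⟩
      sum< n (λ y → h (y + c))                ≡⟨ sum<-periodic n h (λ y → cong (λ z → ⟦ n ∸ q ≤ᵇ z ⟧) ([m+n]%n≡m%n y n)) c ⟩
      sum< n h                                ≡⟨ sum<-cong n (λ y<n → cong (λ z → ⟦ n ∸ q ≤ᵇ z ⟧) (m<n⇒m%n≡m y<n)) ⟩
      sum< n (λ y → ⟦ n ∸ q ≤ᵇ y ⟧)           ≡⟨ sum<-≤ᵇ n (n ∸ q) ⟩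
      n ∸ (n ∸ q)                             ≡⟨ m∸[m∸n]≡n q≤n ⟩
      q                                       ∎
      where
      h : ℕ → ℕ
      h y = ⟦ n ∸ q ≤ᵇ y % n ⟧

    mechanical-column-count : ∀ q → q ≤ n → ∀ i → sum< n (λ j → ⟦ mechanical q (m ∸ j) i ⟧) ≡ q
    mechanical-column-count q q≤n i =
      trans (sum<-reverse m (λ y → ⟦ n ∸ q ≤ᵇ (i * q + y) % n ⟧)) (residue-window-count q q≤n (i * q))

    -- p' is an inverse of p modulo n, so moving the position by l·p' moves the intercept by l.
    mechanical-shift : ∀ {p p' K} → p * p' ≡ 1 + K * n → ∀ s l x →
                       mechanical p s ((x + l * p') % n) ≡ mechanical p (s + l) x
    mechanical-shift {p} {p'} {K} pp' s l x =
      cong (n ∸ p ≤ᵇ_) (%-cong-multiples _ _ (t * p) (l * K) (begin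
        k * p + s + t * p * n        ≡⟨ xy∙z≈xz∙y (k * p) s (t * p * n) ⟩
        k * p + t * p * n + s        ≡⟨ cong (_+ s) ([m%n]*o+[m/n]*o*n≡m*o (x + l * p') p) ⟩
        (x + l * p') * p + s         ≡⟨ expand₂ x l p' p s ⟩
        x * p + s + l * (p * p')     ≡⟨ cong (λ z → x * p + s + l * z) pp' ⟩
        x * p + s + l * (1 + K * n)  ≡⟨ expand₃ x p s l K n ⟩
        x * p + (s + l) + l * K * n  ∎))
      where
      k = (x + l * p') % n
      t = (x + l * p') / n
      expand₂ : ∀ x l p' p s → (x + l * p') * p + s ≡ x * p + s + l * (p * p')
      expand₂ = solve-∀
      expand₃ : ∀ x p s l K n → x * p + s + l * (1 + K * n) ≡ x * p + (s + l) + l * K * n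
      expand₃ = solve-∀

    %-reflect : ∀ x e → x < n → (e + (m ∸ (x + e) % n)) % n ≡ m ∸ x
    %-reflect x e x<n = %-unique t (+-cancelʳ-≡ x _ _ (begin
      e + (m ∸ k) + x      ≡⟨ xy∙z≈y∙zx e (m ∸ k) x ⟩
      (m ∸ k) + (x + e)    ≡⟨ cong ((m ∸ k) +_) (m≡m%n+[m/n]*n (x + e) n) ⟩
      (m ∸ k) + (k + t * n) ≡⟨ +-assoc (m ∸ k) k _ ⟨
      (m ∸ k) + k + t * n  ≡⟨ cong (_+ t * n) (m∸n+n≡m (s≤s⁻¹ (m%n<n (x + e) n))) ⟩
      m + t * n            ≡⟨ cong (_+ t * n) (m∸n+n≡m (s≤s⁻¹ x<n)) ⟨
      (m ∸ x) + x + t * n  ≡⟨ xy∙z≈xz∙y (m ∸ x) x _ ⟩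
      (m ∸ x) + t * n + x  ∎)) (s≤s (m∸n≤m m x))
      where
      k = (x + e) % n
      t = (x + e) / n

    ∸-≤ᵇ-∸ : ∀ p x → p ≤ n → x < n → (n ∸ p ≤ᵇ m ∸ x) ≡ (x <ᵇ p)
    ∸-≤ᵇ-∸ p x p≤n x<n with x <? p
    ... | yes x<p = trans (≤ᵇ-true (∸-monoʳ-≤ n x<p)) (sym (≤ᵇ-true {suc x} x<p))
    ... | no x≮p  = trans (≤ᵇ-false m∸x<n∸p) (sym (≤ᵇ-false {suc x} (s≤s (≮⇒≥ x≮p))))
      where
      m∸x<n∸p : m ∸ x < n ∸ p
      m∸x<n∸p = subst (_≤ n ∸ p) (+-∸-assoc 1 (s≤s⁻¹ x<n)) (∸-monoʳ-≤ n (≮⇒≥ x≮p))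

    /-≡1 : ∀ {a} → n ≤ a → a < n + n → a / n ≡ 1
    /-≡1 {a} n≤a a<2n = /-unique 1 (trans (sym (m∸n+n≡m n≤a)) (cong (a ∸ n +_) (sym (*-identityˡ n))))
                                   (m<n+o⇒m∸n<o a n a<2n)

    diagonal-carry : ∀ {j l} → j < n → l < n → suc (m ∸ j + l) / n ≡ ⟦ j ≡ᵇ l ⟧ + (m ∸ j + l) / n
    diagonal-carry {j} {l} j<n l<n with <-cmp j l
    ... | tri≈ _ refl _ = begin
      suc (m ∸ j + j) / n          ≡⟨ cong (λ z → suc z / n) m∸j+j≡m ⟩
      n / n                        ≡⟨ n/n≡1 n ⟩
      1 + 0                        ≡⟨ cong₂ _+_ (cong ⟦_⟧ (≡ᵇ-true {j} refl)) (m<n⇒m/n≡0 (n<1+n m)) ⟨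
      ⟦ j ≡ᵇ j ⟧ + m / n           ≡⟨ cong (λ z → ⟦ j ≡ᵇ j ⟧ + z / n) m∸j+j≡m ⟨
      ⟦ j ≡ᵇ j ⟧ + (m ∸ j + j) / n ∎
      where
      m∸j+j≡m : m ∸ j + j ≡ m
      m∸j+j≡m = m∸n+n≡m (s≤s⁻¹ j<n)
    ... | tri< j<l j≢l _ = begin
      suc (m ∸ j + l) / n           ≡⟨ /-≡1 (m≤n⇒m≤1+n n≤a) (s≤s 1+a≤m+n) ⟩
      1                             ≡⟨ /-≡1 n≤a (≤-trans 1+a≤m+n (n≤1+n _)) ⟨
      (m ∸ j + l) / n               ≡⟨ cong (λ b → ⟦ b ⟧ + (m ∸ j + l) / n) (≡ᵇ-false j≢l) ⟨
      ⟦ j ≡ᵇ l ⟧ + (m ∸ j + l) / n  ∎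
      where
      n≤a : n ≤ m ∸ j + l
      n≤a = subst (_≤ m ∸ j + l) (trans (+-suc (m ∸ j) j) (cong suc (m∸n+n≡m (s≤s⁻¹ j<n))))
                  (+-monoʳ-≤ (m ∸ j) j<l)
      1+a≤m+n : suc (m ∸ j + l) ≤ m + n
      1+a≤m+n = subst (_≤ m + n) (+-suc (m ∸ j) l) (+-mono-≤ (m∸n≤m m j) l<n)
    ... | tri> _ j≢l l<j = begin
      suc (m ∸ j + l) / n           ≡⟨ m<n⇒m/n≡0 (s≤s 1+a≤m) ⟩
      0                             ≡⟨ m<n⇒m/n≡0 (s≤s (≤-trans (n≤1+n _) 1+a≤m)) ⟨
      (m ∸ j + l) / n               ≡⟨ cong (λ b → ⟦ b ⟧ + (m ∸ j + l) / n) (≡ᵇ-false j≢l) ⟨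
      ⟦ j ≡ᵇ l ⟧ + (m ∸ j + l) / n  ∎
      where
      1+a≤m : suc (m ∸ j + l) ≤ m
      1+a≤m = subst₂ _≤_ (+-suc (m ∸ j) l) (m∸n+n≡m (s≤s⁻¹ j<n)) (+-monoʳ-≤ (m ∸ j) l<j)

    mechanical-product-count :
      ∀ {p p' K} → p ≤ n → p' ≤ n → p * p' ≡ 1 + K * n → ∀ {j l} → j < n → l < n →
      sum< n (λ k → ⟦ mechanical p (m ∸ j) k ∧ mechanical p' (m ∸ k) l ⟧) ≡ K + ⟦ j ≡ᵇ l ⟧
    mechanical-product-count {p} {p'} {K} p≤n p'≤n pp' {j} {l} j<n l<n =
      +-cancelʳ-≡ (c / n) _ _ (begin
        sum< n F + c / n                              ≡⟨ cong (_+ c / n) reindexed ⟩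
        sum< p' (λ x → ⟦ mechanical p c x ⟧) + c / n  ≡⟨ sum<-mechanical p p≤n p' c ⟩
        (p' * p + c) / n                              ≡⟨ cong (λ z → (z + c) / n) (trans (*-comm p' p) pp') ⟩
        (suc (K * n) + c) / n                         ≡⟨ cong (_/ n) (+-comm (suc (K * n)) c) ⟩
        (c + suc (K * n)) / n                         ≡⟨ cong (_/ n) (+-suc c (K * n)) ⟩
        (suc c + K * n) / n                           ≡⟨ /-+-multiple {n} (suc c) K ⟩
        suc c / n + K                                 ≡⟨ cong (_+ K) (diagonal-carry j<n l<n) ⟩
        ⟦ j ≡ᵇ l ⟧ + c / n + K                        ≡⟨ xy∙z≈z∙xy ⟦ j ≡ᵇ l ⟧ (c / n) K ⟩
        K + (⟦ j ≡ᵇ l ⟧ + c / n)                      ≡⟨ +-assoc K _ _ ⟨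
        K + ⟦ j ≡ᵇ l ⟧ + c / n                        ∎)
      where
      c = m ∸ j + l
      F : ℕ → ℕ
      F k = ⟦ mechanical p (m ∸ j) k ∧ mechanical p' (m ∸ k) l ⟧
      -- Substituting k = (x + l·p') % n turns the second factor into x <ᵇ p'.
      reindexed : sum< n F ≡ sum< p' (λ x → ⟦ mechanical p c x ⟧)
      reindexed = begin
        sum< n F                             ≡⟨ sum<-cong n (λ y<n → cong F (m<n⇒m%n≡m y<n)) ⟨
        sum< n (λ y → F (y % n))             ≡⟨ sum<-periodic n (λ y → F (y % n)) (λ y → cong F ([m+n]%n≡m%n y n)) (l * p') ⟨
        sum< n (λ x → F ((x + l * p') % n))  ≡⟨ sum<-cong n (λ {x} x<n → cong₂ (λ a b → ⟦ a ∧ b ⟧)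
                                                 (mechanical-shift {p} {p'} {K} pp' (m ∸ j) l x)
                                                 (trans (cong (n ∸ p' ≤ᵇ_) (%-reflect x (l * p') x<n)) (∸-≤ᵇ-∸ p' x p'≤n x<n))) ⟩
        sum< n (λ x → ⟦ mechanical p c x ∧ (x <ᵇ p') ⟧)  ≡⟨ sum<-∧-<ᵇ n p' (mechanical p c) p'≤n ⟩
        sum< p' (λ x → ⟦ mechanical p c x ⟧) ∎

    step : ℕ → ℕ → ℕ
    step q s = (q + s) % n

    prefix : ℕ → (L : ℕ) → ℕ → Word L
    prefix q L s i = mechanical q s (toℕ i)

    orbit-suc : ∀ q i s → (suc i * q + s) % n ≡ (i * q + step q s) % n
    orbit-suc q i s = %-cong-multiples _ _ 0 ((q + s) / n) (begin
      suc i * q + s + 0 * n                    ≡⟨ +-identityʳ _ ⟩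
      q + i * q + s                            ≡⟨ xy∙z≈y∙xz q (i * q) s ⟩
      i * q + (q + s)                          ≡⟨ cong (i * q +_) (m≡m%n+[m/n]*n (q + s) n) ⟩
      i * q + ((q + s) % n + (q + s) / n * n)  ≡⟨ +-assoc (i * q) _ _ ⟨
      i * q + step q s + (q + s) / n * n       ∎)

    scale : ℕ → Fin n → Fin n
    scale a i = (toℕ i * a) mod n

    scale-inverse : ∀ {a b K} → b * a ≡ 1 + K * n → ∀ y → scale a (scale b y) ≡ y
    scale-inverse {a} {b} {K} ba y = toℕ-injective (begin
      toℕ (scale a (scale b y))         ≡⟨ toℕ-mod (toℕ (scale b y) * a) ⟩
      toℕ (scale b y) * a % n           ≡⟨ cong (λ z → z * a % n) (toℕ-mod (toℕ y * b)) ⟩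
      (toℕ y * b) % n * a % n           ≡⟨ %-*-inverse {a = b} {b = a} {K = K} ba (toℕ<n y) ⟩
      toℕ y                             ∎)

    module _ {q : ℕ} (q≤n : q ≤ n) where

      christoffel≡mechanical : ∀ (i : Fin n) → christoffel n q i ≡ (n ∸ q ≤ᵇ (toℕ i * q) % n)
      christoffel≡mechanical i =
        trans (cong ((toℕ i * q) / n <ᵇ_) (/-carry q (toℕ i * q) q≤n)) (<ᵇ-⟦⟧+ _ _)

      rotate-christoffel : ∀ k i → rotate (christoffel n q) k i ≡ mechanical q ((toℕ k * q) % n) (toℕ i)
      rotate-christoffel k i = trans (christoffel≡mechanical ((a + b) mod n)) (cong (n ∸ q ≤ᵇ_) (begin
        toℕ ((a + b) mod n) * q % n  ≡⟨ cong (λ z → z * q % n) (toℕ-mod (a + b)) ⟩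
        (a + b) % n * q % n          ≡⟨ %-cong-multiples _ _ ((a + b) / n * q) (b * q / n) (begin
          (a + b) % n * q + (a + b) / n * q * n  ≡⟨ [m%n]*o+[m/n]*o*n≡m*o (a + b) q ⟩
          (a + b) * q                            ≡⟨ *-distribʳ-+ q a b ⟩
          a * q + b * q                          ≡⟨ cong (a * q +_) (m≡m%n+[m/n]*n (b * q) n) ⟩
          a * q + ((b * q) % n + b * q / n * n)  ≡⟨ +-assoc (a * q) _ _ ⟨
          a * q + (b * q) % n + b * q / n * n    ∎) ⟩
        (a * q + (b * q) % n) % n    ∎))
        where
        a = toℕ i
        b = toℕ k

      n≤q+s : ∀ {s} → n ∸ q ≤ s → n ≤ q + s
      n≤q+s {s} high = subst (_≤ q + s) (m+[n∸m]≡n q≤n) (+-monoʳ-≤ q high)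

      letter-high : ∀ {s} → s < n → n ∸ q ≤ s → mechanical q s 0 ≡ true
      letter-high s<n high = trans (cong (n ∸ q ≤ᵇ_) (m<n⇒m%n≡m s<n)) (≤ᵇ-true high)

      letter-low : ∀ {s} → s < n → ¬ (n ∸ q ≤ s) → mechanical q s 0 ≡ false
      letter-low s<n low = trans (cong (n ∸ q ≤ᵇ_) (m<n⇒m%n≡m s<n)) (≤ᵇ-false (≰⇒> low))

      step-high : ∀ {s} → s < n → n ∸ q ≤ s → step q s ≡ q + s ∸ n
      step-high {s} s<n high =
        %-unique 1 (trans (sym (m∸n+n≡m (n≤q+s high))) (cong (q + s ∸ n +_) (sym (*-identityˡ n))))
                   (m<n+o⇒m∸n<o (q + s) n (+-mono-≤-< q≤n s<n))

      step-low : ∀ {s} → ¬ (n ∸ q ≤ s) → step q s ≡ q + s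
      step-low {s} low = m<n⇒m%n≡m (subst (q + s <_) (m+[n∸m]≡n q≤n) (+-monoʳ-< q (≰⇒> low)))

      lexGt-prefix-suc : ∀ L {s s' b b'} → mechanical q s 0 ≡ b → mechanical q s' 0 ≡ b' →
        lexGt (prefix q (suc L) s) (prefix q (suc L) s') ≡
        lexStep b b' (lexGt (prefix q L (step q s)) (prefix q L (step q s')))
      lexGt-prefix-suc L {s} {s'} {b} {b'} eb eb' = begin
        lexGt (prefix q (suc L) s) (prefix q (suc L) s')
          ≡⟨ lexGt-suc (prefix q (suc L) s) (prefix q (suc L) s') ⟩
        lexStep (mechanical q s 0) (mechanical q s' 0) tails
          ≡⟨ cong₂ (λ a b → lexStep a b tails) eb eb' ⟩
        lexStep b b' tails
          ≡⟨ cong (lexStep b b') (lexGt-cong {L} (λ i → cong (n ∸ q ≤ᵇ_) (orbit-suc q (toℕ i) s))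
                                                 (λ i → cong (n ∸ q ≤ᵇ_) (orbit-suc q (toℕ i) s'))) ⟩
        lexStep b b' (lexGt (prefix q L (step q s)) (prefix q L (step q s'))) ∎
        where
        tails : Bool
        tails = lexGt {L} (λ i → mechanical q s (suc (toℕ i))) (λ i → mechanical q s' (suc (toℕ i)))

      lexGt-prefix-≤ : ∀ L {s s'} → s < n → s' < n → s ≤ s' → lexGt (prefix q L s) (prefix q L s') ≡ false
      lexGt-prefix-≤ zero    _ _ _ = refl
      lexGt-prefix-≤ (suc L) {s} {s'} s<n s'<n s≤s' = by-letters (n ∸ q ≤? s) (n ∸ q ≤? s')
        where
        next : step q s ≤ step q s' → lexGt (prefix q L (step q s)) (prefix q L (step q s')) ≡ false
        next = lexGt-prefix-≤ L (m%n<n (q + s) n) (m%n<n (q + s') n)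
        by-letters : Dec (n ∸ q ≤ s) → Dec (n ∸ q ≤ s') → lexGt (prefix q (suc L) s) (prefix q (suc L) s') ≡ false
        by-letters (yes high) (yes high') =
          trans (lexGt-prefix-suc L (letter-high s<n high) (letter-high s'<n high'))
                (next (subst₂ _≤_ (sym (step-high s<n high)) (sym (step-high s'<n high')) (∸-monoˡ-≤ n (+-monoʳ-≤ q s≤s'))))
        by-letters (yes high) (no low')  = contradiction (≤-trans high s≤s') low'
        by-letters (no low)   (yes high') = lexGt-prefix-suc L (letter-low s<n low) (letter-high s'<n high')
        by-letters (no low)   (no low')  =
          trans (lexGt-prefix-suc L (letter-low s<n low) (letter-low s'<n low'))
                (next (subst₂ _≤_ (sym (step-low low)) (sym (step-low low')) (+-monoʳ-≤ q s≤s')))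

      -- The orbit of s' reaching the top residue m within L steps forces the words apart.
      lexGt-prefix-> : ∀ L {s s'} → s < n → s' < n → s' < s → ∀ i → i < L → (i * q + s') % n ≡ m →
                       lexGt (prefix q L s) (prefix q L s') ≡ true
      lexGt-prefix-> L {s} {s'} s<n s'<n s'<s zero _ top =
        contradiction (trans (sym (m<n⇒m%n≡m s'<n)) top) (<⇒≢ (<-≤-trans s'<s (s≤s⁻¹ s<n)))
      lexGt-prefix-> (suc L) {s} {s'} s<n s'<n s'<s (suc i) i<L top = by-letters (n ∸ q ≤? s) (n ∸ q ≤? s')
        where
        next : step q s' < step q s → lexGt (prefix q L (step q s)) (prefix q L (step q s')) ≡ true
        next lt = lexGt-prefix-> L (m%n<n (q + s) n) (m%n<n (q + s') n) lt i (s≤s⁻¹ i<L)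
                                 (trans (sym (orbit-suc q i s')) top)
        by-letters : Dec (n ∸ q ≤ s) → Dec (n ∸ q ≤ s') → lexGt (prefix q (suc L) s) (prefix q (suc L) s') ≡ true
        by-letters (yes high) (yes high') =
          trans (lexGt-prefix-suc L (letter-high s<n high) (letter-high s'<n high'))
                (next (subst₂ _<_ (sym (step-high s'<n high')) (sym (step-high s<n high))
                                  (∸-monoˡ-< (+-monoʳ-< q s'<s) (n≤q+s high'))))
        by-letters (yes high) (no low')  = lexGt-prefix-suc L (letter-high s<n high) (letter-low s'<n low')
        by-letters (no low)   (yes high') = contradiction (≤-trans high' (<⇒≤ s'<s)) low
        by-letters (no low)   (no low')  =
          trans (lexGt-prefix-suc L (letter-low s<n low) (letter-low s'<n low'))
                (next (subst₂ _<_ (sym (step-low low')) (sym (step-low low)) (+-monoʳ-< q s'<s)))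

      module _ {q' K : ℕ} (qq' : q * q' ≡ 1 + K * n) where

        q'q : q' * q ≡ 1 + K * n
        q'q = trans (*-comm q' q) qq'

        orbit-hits-top : ∀ {s} → s < n → ((m ∸ s) * q' % n * q + s) % n ≡ m
        orbit-hits-top {s} s<n = begin
          ((m ∸ s) * q' % n * q + s) % n            ≡⟨ %-distribˡ-+ ((m ∸ s) * q' % n * q) s n ⟩
          ((m ∸ s) * q' % n * q % n + s % n) % n
            ≡⟨ cong₂ (λ a b → (a + b) % n) (%-*-inverse {a = q'} {b = q} {K = K} q'q (s≤s (m∸n≤m m s))) (m<n⇒m%n≡m s<n) ⟩
          (m ∸ s + s) % n                           ≡⟨ cong (_% n) (m∸n+n≡m (s≤s⁻¹ s<n)) ⟩
          m % n                                     ≡⟨ m<n⇒m%n≡m (n<1+n m) ⟩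
          m                                         ∎

        lexGt-prefix : ∀ {s s'} → s < n → s' < n → lexGt (prefix q n s') (prefix q n s) ≡ (s <ᵇ s')
        lexGt-prefix {s} {s'} s<n s'<n with <-cmp s s'
        ... | tri< s<s' _ _ = trans (lexGt-prefix-> n s'<n s<n s<s' ((m ∸ s) * q' % n) (m%n<n ((m ∸ s) * q') n) (orbit-hits-top s<n))
                                    (sym (≤ᵇ-true {suc s} s<s'))
        ... | tri≈ _ refl _ = trans (lexGt-prefix-≤ n s<n s<n ≤-refl) (sym (≤ᵇ-false {suc s} ≤-refl))
        ... | tri> _ _ s'<s = trans (lexGt-prefix-≤ n s'<n s<n (<⇒≤ s'<s)) (sym (≤ᵇ-false {suc s} (m<n⇒m<1+n s'<s)))

        sum<-*-% : ∀ (f : ℕ → ℕ) → sum< n (λ x → f ((x * q) % n)) ≡ sum< n f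
        sum<-*-% f = begin
          sum< n (λ x → f ((x * q) % n))          ≡⟨ sum≡sum< {n} (λ x → f ((x * q) % n)) ⟨
          FinSum.sum {n} (λ i → f ((toℕ i * q) % n))  ≡⟨ FinSum.sum-cong-≗ {n} (λ i → cong f (toℕ-mod {n} (toℕ i * q))) ⟨
          FinSum.sum {n} (λ i → f (toℕ (scale q i)))  ≡⟨ FinSum.sum-permute {n} {n} (λ i → f (toℕ i)) π ⟨
          FinSum.sum {n} (λ i → f (toℕ i))            ≡⟨ sum≡sum< f ⟩
          sum< n f                                ∎
          where
          π = permutation (scale q) (scale q') (scale-inverse {q} {q'} {K} q'q) (scale-inverse {q'} {q} {K} qq')

        rank-christoffel : ∀ k → rank (christoffel n q) k ≡ m ∸ (toℕ k * q) % n
        rank-christoffel k = begin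
          rank (christoffel n q) k             ≡⟨ count≡sum< _ (λ x → c <ᵇ (x * q) % n) rotation-order ⟩
          sum< n (λ x → ⟦ c <ᵇ (x * q) % n ⟧)  ≡⟨ sum<-*-% (λ y → ⟦ suc c ≤ᵇ y ⟧) ⟩
          sum< n (λ y → ⟦ suc c ≤ᵇ y ⟧)        ≡⟨ sum<-≤ᵇ n (suc c) ⟩
          m ∸ c                                ∎
          where
          c = (toℕ k * q) % n
          rotation-order : ∀ k' → lexGt (rotate (christoffel n q) k') (rotate (christoffel n q) k) ≡
                                  (c <ᵇ (toℕ k' * q) % n)
          rotation-order k' = trans (lexGt-cong (rotate-christoffel k') (rotate-christoffel k))
                                    (lexGt-prefix (m%n<n (toℕ k * q) n) (m%n<n (toℕ k' * q) n))

        sortedRow-christoffel : ∀ j i → sortedRow (christoffel n q) j i ≡ mechanical q (m ∸ toℕ j) (toℕ i)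
        sortedRow-christoffel j i =
          sortedRow-elim (christoffel n q) j (λ row → row i ≡ mechanical q (m ∸ toℕ j) (toℕ i))
                         row-of-rank-j (k₀ , rank-k₀)
          where
          m∸j<n : m ∸ toℕ j < n
          m∸j<n = s≤s (m∸n≤m m (toℕ j))
          residue : ∀ k → rank (christoffel n q) k ≡ toℕ j → (toℕ k * q) % n ≡ m ∸ toℕ j
          residue k rank≡j = begin
            (toℕ k * q) % n              ≡⟨ m∸[m∸n]≡n (s≤s⁻¹ (m%n<n (toℕ k * q) n)) ⟨
            m ∸ (m ∸ (toℕ k * q) % n)    ≡⟨ cong (m ∸_) (trans (sym (rank-christoffel k)) rank≡j) ⟩
            m ∸ toℕ j                    ∎
          row-of-rank-j : ∀ k → rank (christoffel n q) k ≡ toℕ j →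
                          rotate (christoffel n q) k i ≡ mechanical q (m ∸ toℕ j) (toℕ i)
          row-of-rank-j k rank≡j =
            trans (rotate-christoffel k i) (cong (λ s → mechanical q s (toℕ i)) (residue k rank≡j))
          k₀ : Fin n
          k₀ = scale q' (fromℕ< m∸j<n)
          residue-k₀ : (toℕ k₀ * q) % n ≡ m ∸ toℕ j
          residue-k₀ = begin
            (toℕ k₀ * q) % n          ≡⟨ toℕ-mod (toℕ k₀ * q) ⟨
            toℕ (scale q k₀)          ≡⟨ cong toℕ (scale-inverse {q} {q'} {K} q'q (fromℕ< m∸j<n)) ⟩
            toℕ (fromℕ< m∸j<n)        ≡⟨ toℕ-fromℕ< m∸j<n ⟩
            m ∸ toℕ j                 ∎
          rank-k₀ : rank (christoffel n q) k₀ ≡ toℕ j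
          rank-k₀ = begin
            rank (christoffel n q) k₀   ≡⟨ rank-christoffel k₀ ⟩
            m ∸ (toℕ k₀ * q) % n        ≡⟨ cong (m ∸_) residue-k₀ ⟩
            m ∸ (m ∸ toℕ j)             ≡⟨ m∸[m∸n]≡n (s≤s⁻¹ (toℕ<n j)) ⟩
            toℕ j                       ∎

module ChristoffelMatrices {c ℓ} (F : Field c ℓ) where
  open import Data.Nat as ℕ using (ℕ; zero; suc; _≤_; _∸_)
  import Data.Nat.Properties as ℕ
  open import Data.Bool using (Bool; true; false; _∧_; if_then_else_)
  open import Data.Bool.Properties using (∧-comm)
  open import Data.Fin using (Fin; toℕ) renaming (zero to fzero; suc to fsuc)
  open import Data.Fin.Properties using (toℕ<n)
  open import Data.Product using (_,_)
  open import Relation.Binary.PropositionalEquality as ≡ using (_≡_)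
  open Field F
  open FieldOps F
  open Combinatorics using (⟦_⟧; count≡sum<; ⌊≟⌋≡toℕ-≡ᵇ)
  open import Relation.Binary.Reasoning.Setoid setoid
  open import Algebra.Properties.Ring ring using (-‿distribʳ-*)
  import Algebra.Properties.Semiring.Sum semiring as Sum

  ·1-+ : ∀ a b → (a ℕ.+ b) ·1 ≈ a ·1 + b ·1
  ·1-+ zero    b = sym (+-identityˡ (b ·1))
  ·1-+ (suc a) b = trans (+-congˡ (·1-+ a b)) (sym (+-assoc 1# (a ·1) (b ·1)))

  ⟦⟧·1 : ∀ b → ⟦ b ⟧ ·1 ≈ (if b then 1# else 0#)
  ⟦⟧·1 true  = +-identityʳ 1#
  ⟦⟧·1 false = refl

  ∑≡sum : ∀ {N} (f : Fin N → Carrier) → ∑ f ≡ Sum.sum f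
  ∑≡sum {zero}  f = ≡.refl
  ∑≡sum {suc N} f = ≡.cong (f fzero +_) (∑≡sum {N} (λ i → f (fsuc i)))

  ∑-cong : ∀ {N} {f g : Fin N → Carrier} → (∀ k → f k ≈ g k) → ∑ f ≈ ∑ g
  ∑-cong {N} {f} {g} f≈g = begin
    ∑ f        ≡⟨ ∑≡sum f ⟩
    Sum.sum f  ≈⟨ Sum.sum-cong-≋ f≈g ⟩
    Sum.sum g  ≡⟨ ∑≡sum g ⟨
    ∑ g        ∎

  sum-indicator : ∀ {N} (p : Fin N → Bool) → Sum.sum (λ k → if p k then 1# else 0#) ≈ count p ·1
  sum-indicator {zero}  p = refl
  sum-indicator {suc N} p = begin
    (if p fzero then 1# else 0#) + Sum.sum (λ k → if p (fsuc k) then 1# else 0#)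
      ≈⟨ +-cong (sym (⟦⟧·1 (p fzero))) (sum-indicator (λ k → p (fsuc k))) ⟩
    ⟦ p fzero ⟧ ·1 + count (λ k → p (fsuc k)) ·1
      ≈⟨ ·1-+ ⟦ p fzero ⟧ (count (λ k → p (fsuc k))) ⟨
    count p ·1 ∎

  indicator-product : ∀ a b γ → (if a then 1# else 0#) * (if b then 1# - γ else - γ) ≈
                                (if a ∧ b then 1# else 0#) + (if a then 1# else 0#) * - γ
  indicator-product true  true  γ = trans (*-identityˡ (1# - γ)) (+-congˡ (sym (*-identityˡ (- γ))))
  indicator-product true  false γ = sym (+-identityˡ (1# * - γ))
  indicator-product false b     γ = trans (zeroˡ _) (sym (trans (+-identityˡ (0# * - γ)) (zeroˡ (- γ))))

  ∑-indicator-product : ∀ {N} (a b : Fin N → Bool) γ →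
    ∑ (λ k → (if a k then 1# else 0#) * (if b k then 1# - γ else - γ)) ≈
    count (λ k → a k ∧ b k) ·1 + count a ·1 * - γ
  ∑-indicator-product {N} a b γ = begin
    ∑ (λ k → A k * (if b k then 1# - γ else - γ))
      ≡⟨ ∑≡sum {N} (λ k → A k * (if b k then 1# - γ else - γ)) ⟩
    Sum.sum (λ k → A k * (if b k then 1# - γ else - γ))
      ≈⟨ Sum.sum-cong-≋ (λ k → indicator-product (a k) (b k) γ) ⟩
    Sum.sum (λ k → (if a k ∧ b k then 1# else 0#) + A k * - γ)
      ≈⟨ Sum.∑-distrib-+ (λ k → if a k ∧ b k then 1# else 0#) (λ k → A k * - γ) ⟩
    Sum.sum (λ k → if a k ∧ b k then 1# else 0#) + Sum.sum (λ k → A k * - γ)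
      ≈⟨ +-congˡ (Sum.*-distribʳ-sum (- γ) A) ⟨
    Sum.sum (λ k → if a k ∧ b k then 1# else 0#) + Sum.sum A * - γ
      ≈⟨ +-cong (sum-indicator (λ k → a k ∧ b k)) (*-congʳ (sum-indicator a)) ⟩
    count (λ k → a k ∧ b k) ·1 + count a ·1 * - γ ∎
    where
    A = λ k → if a k then 1# else 0#

  ∑-indicator-product-cancel :
    ∀ {N} (a b : Fin N → Bool) {γ Q d r} → count (λ k → a k ∧ b k) ≡ Q ℕ.+ d → count a ≡ r →
    r ·1 * γ ≈ Q ·1 → ∑ (λ k → (if a k then 1# else 0#) * (if b k then 1# - γ else - γ)) ≈ d ·1
  ∑-indicator-product-cancel a b {γ} {Q} {d} {r} count-a∧b count-a rγ≈Q = begin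
    ∑ (λ k → (if a k then 1# else 0#) * (if b k then 1# - γ else - γ))
      ≈⟨ ∑-indicator-product a b γ ⟩
    count (λ k → a k ∧ b k) ·1 + count a ·1 * - γ
      ≡⟨ ≡.cong₂ (λ x y → x ·1 + y ·1 * - γ) count-a∧b count-a ⟩
    (Q ℕ.+ d) ·1 + r ·1 * - γ
      ≈⟨ +-cong (·1-+ Q d) (trans (sym (-‿distribʳ-* (r ·1) γ)) (-‿cong rγ≈Q)) ⟩
    Q ·1 + d ·1 + - (Q ·1)
      ≈⟨ +-congʳ (+-comm (Q ·1) (d ·1)) ⟩
    d ·1 + Q ·1 + - (Q ·1)
      ≈⟨ +-assoc (d ·1) (Q ·1) (- (Q ·1)) ⟩
    d ·1 + (Q ·1 + - (Q ·1))
      ≈⟨ +-congˡ (-‿inverseʳ (Q ·1)) ⟩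
    d ·1 + 0#
      ≈⟨ +-identityʳ (d ·1) ⟩
    d ·1 ∎

  diagonal : ∀ {N} (j l : Fin N) → ⟦ toℕ j ℕ.≡ᵇ toℕ l ⟧ ·1 ≈ identity j l
  diagonal j l = trans (⟦⟧·1 _) (reflexive (≡.cong (λ b → if b then 1# else 0#) (≡.sym (⌊≟⌋≡toℕ-≡ᵇ j l))))

  module _ (m : ℕ) where
    open Combinatorics.MechanicalWords m

    M-christoffel : ∀ {q q' K} → q ≤ n → q ℕ.* q' ≡ 1 ℕ.+ K ℕ.* n → ∀ a b j i →
                    M F n a b q j i ≡ (if mechanical q (m ∸ toℕ j) (toℕ i) then b else a)
    M-christoffel {K = K} q≤n qq' a b j i =
      ≡.cong (λ w → if w then b else a) (sortedRow-christoffel q≤n {K = K} qq' j i)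

    -- γ = K/p, stated without division.
    module _ {p p' K γ} (p≤n : p ≤ n) (p'≤n : p' ≤ n) (pp' : p ℕ.* p' ≡ 1 ℕ.+ K ℕ.* n)
             (pγ≈K : p ·1 * γ ≈ K ·1) where

      p'p : p' ℕ.* p ≡ 1 ℕ.+ K ℕ.* n
      p'p = ≡.trans (ℕ.*-comm p' p) pp'

      christoffel-inverseʳ : (M F n 0# 1# p ⊗ M F n (- γ) (1# - γ) p') ≈ₘ identity
      christoffel-inverseʳ j l = begin
        (M F n 0# 1# p ⊗ M F n (- γ) (1# - γ) p') j l
          ≈⟨ ∑-cong (λ i → reflexive (≡.cong₂ _*_ (M-christoffel {K = K} p≤n pp' 0# 1# j i)
                                                  (M-christoffel {K = K} p'≤n p'p (- γ) (1# - γ) i l))) ⟩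
        ∑ (λ i → (if a i then 1# else 0#) * (if b i then 1# - γ else - γ))
          ≈⟨ ∑-indicator-product-cancel a b {Q = K} count-a∧b count-a pγ≈K ⟩
        ⟦ toℕ j ℕ.≡ᵇ toℕ l ⟧ ·1
          ≈⟨ diagonal j l ⟩
        identity j l ∎
        where
        a b : Fin n → Bool
        a i = mechanical p (m ∸ toℕ j) (toℕ i)
        b i = mechanical p' (m ∸ toℕ i) (toℕ l)
        count-a∧b : count (λ i → a i ∧ b i) ≡ K ℕ.+ ⟦ toℕ j ℕ.≡ᵇ toℕ l ⟧
        count-a∧b = ≡.trans (count≡sum< {n} _ (λ x → mechanical p (m ∸ toℕ j) x ∧ mechanical p' (m ∸ x) (toℕ l))
                                          (λ _ → ≡.refl))
                            (mechanical-product-count {K = K} p≤n p'≤n pp' (toℕ<n j) (toℕ<n l))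
        count-a : count a ≡ p
        count-a = ≡.trans (count≡sum< {n} a (mechanical p (m ∸ toℕ j)) (λ _ → ≡.refl))
                          (mechanical-count p p≤n (m ∸ toℕ j))

      christoffel-inverseˡ : (M F n (- γ) (1# - γ) p' ⊗ M F n 0# 1# p) ≈ₘ identity
      christoffel-inverseˡ j l = begin
        (M F n (- γ) (1# - γ) p' ⊗ M F n 0# 1# p) j l
          ≈⟨ ∑-cong (λ i → trans (*-comm _ _) (reflexive (≡.cong₂ _*_ (M-christoffel {K = K} p≤n pp' 0# 1# i l)
                                                                     (M-christoffel {K = K} p'≤n p'p (- γ) (1# - γ) j i)))) ⟩
        ∑ (λ i → (if a i then 1# else 0#) * (if b i then 1# - γ else - γ))
          ≈⟨ ∑-indicator-product-cancel a b {Q = K} count-a∧b count-a pγ≈K ⟩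
        ⟦ toℕ j ℕ.≡ᵇ toℕ l ⟧ ·1
          ≈⟨ diagonal j l ⟩
        identity j l ∎
        where
        a b : Fin n → Bool
        a i = mechanical p (m ∸ toℕ i) (toℕ l)
        b i = mechanical p' (m ∸ toℕ j) (toℕ i)
        count-a∧b : count (λ i → a i ∧ b i) ≡ K ℕ.+ ⟦ toℕ j ℕ.≡ᵇ toℕ l ⟧
        count-a∧b = ≡.trans (count≡sum< {n} _ (λ x → mechanical p' (m ∸ toℕ j) x ∧ mechanical p (m ∸ x) (toℕ l))
                                          (λ i → ∧-comm (a i) (b i)))
                            (mechanical-product-count {K = K} p'≤n p≤n p'p (toℕ<n j) (toℕ<n l))
        count-a : count a ≡ p
        count-a = ≡.trans (count≡sum< {n} a (λ x → mechanical p (m ∸ x) (toℕ l)) (λ _ → ≡.refl))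
                          (mechanical-column-count p p≤n (toℕ l))

      christoffel-inverse : IsInverseOf (M F n (- γ) (1# - γ) p') (M F n 0# 1# p)
      christoffel-inverse = christoffel-inverseʳ , christoffel-inverseˡ

open import Level using (Level)
open import Data.Nat using (ℕ; _≤_; _∸_; suc; s≤s; z≤n)
import Data.Nat as ℕ
import Data.Nat.Properties as ℕ
open import Data.Nat.Coprimality using (Coprime)
open import Data.Integer using (ℤ; +_; -[1+_])
import Data.Integer as ℤ
import Data.Integer.Properties as ℤ
open import Data.Product using (Σ-syntax; _×_; _,_)
open import Relation.Binary.PropositionalEquality as ≡ using (_≡_)

nonnegative-quotient : ∀ k a (Q : ℤ) → + a ≡ + 1 ℤ.+ Q ℤ.* + suc (suc k) →
                       Σ[ Q' ∈ ℕ ] (Q ≡ + Q' × a ≡ 1 ℕ.+ Q' ℕ.* suc (suc k))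
nonnegative-quotient k a (+ Q') eq = Q' , ≡.refl , ℤ.+-injective (begin
  + a                              ≡⟨ eq ⟩
  + 1 ℤ.+ + Q' ℤ.* + suc (suc k)   ≡⟨ ≡.cong (λ z → + 1 ℤ.+ z) (ℤ.pos-* Q' (suc (suc k))) ⟨
  + 1 ℤ.+ + (Q' ℕ.* suc (suc k))   ≡⟨ ℤ.pos-+ 1 (Q' ℕ.* suc (suc k)) ⟨
  + (1 ℕ.+ Q' ℕ.* suc (suc k))     ∎)
  where open ≡.≡-Reasoning
nonnegative-quotient k a -[1+ j ] ()

corollary5 : ∀ {c ℓ : Level} (F : Field c ℓ) (n r r* : ℕ) (Q : ℤ) →
    FieldOps.CharZeroOrGreaterThan F n → 2 ≤ n →
    1 ≤ r → r ≤ n ∸ 1 → Coprime r n →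
    1 ≤ r* → r* ≤ n ∸ 1 → + (r ℕ.* r*) ≡ + 1 ℤ.+ Q ℤ.* + n →
    let open Field F
        open FieldOps F
    in IsInverseOf (M F n (- (fromℤ Q ÷ (r ·1))) (1# - (fromℤ Q ÷ (r ·1))) r*)
                   (M F n 0# 1# r)
corollary5 F (suc (suc k)) r r* Q char (s≤s (s≤s z≤n)) 1≤r r≤n-1 _ _ r*≤n-1 rr*≡1+Qn
  with nonnegative-quotient k (r ℕ.* r*) Q rr*≡1+Qn
... | Q' , ≡.refl , rr* = christoffel-inverse (suc k) {K = Q'} r≤n r*≤n rr* rγ≈Q'
  where
  open Field F
  open FieldOps F
  open ChristoffelMatrices F using (christoffel-inverse)
  open import Relation.Binary.Reasoning.Setoid setoid
  open import Algebra.Properties.CommutativeSemigroup *-commutativeSemigroup using (x∙yz≈y∙xz)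

  r≤n : r ≤ suc (suc k)
  r≤n = ℕ.≤-trans r≤n-1 (ℕ.n≤1+n _)
  r*≤n : r* ≤ suc (suc k)
  r*≤n = ℕ.≤-trans r*≤n-1 (ℕ.n≤1+n _)

  rγ≈Q' : r ·1 * (Q' ·1 * (r ·1) ⁻¹) ≈ Q' ·1
  rγ≈Q' = begin
    r ·1 * (Q' ·1 * (r ·1) ⁻¹)  ≈⟨ x∙yz≈y∙xz (r ·1) (Q' ·1) ((r ·1) ⁻¹) ⟩
    Q' ·1 * (r ·1 * (r ·1) ⁻¹)  ≈⟨ *-congˡ (⁻¹-inv (r ·1) (char r 1≤r r≤n)) ⟩
    Q' ·1 * 1#                  ≈⟨ *-identityʳ (Q' ·1) ⟩
    Q' ·1                       ∎
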